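{- Let $U=\{u_n\}_{n\ge1}$ be an increasing sequence (finite or infinite) of positive even integers and $V=\{v_n\}_{n\ge1}$ an increasing sequence (finite or infinite) of positive odd integers, with counting functions $U(y)=\#\{n:u_n\le y\}$ and $V(y)=\#\{n:v_n\le y\}$. For a positive odd integer $x$, let $h(x)$ be the number of solutions of $x=u+v$ with $u\in U$, $v\in V$. Then for every odd $x\ge3$, $$h(x)=\sum_{v\in V,\ v\le (x+1)/2}U(x-v)+\sum_{u\in U,\ u\le (x+1)/2}V(x-u)-U\!\left(\tfrac{x+1}{2}\right)V\!\left(\tfrac{x+1}{2}\right)-h(x-2)-h(x-4)-\dots-h(1).$$ -}

module Defs where

open import Data.Nat using (ℕ; zero; suc; _+_; _*_; _∸_)
open import Data.Bool using (Bool; true; false; if_then_else_; _∧_)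

-- A (finite or infinite) increasing sequence of positive integers is
-- represented by its (decidable) membership predicate S : ℕ → Bool.

count : (ℕ → Bool) → ℕ → ℕ
count S zero    = 0
count S (suc y) = (if S (suc y) then 1 else 0) + count S y

sumOver : (ℕ → Bool) → ℕ → (ℕ → ℕ) → ℕ
sumOver S zero    f = 0
sumOver S (suc m) f = (if S (suc m) then f (suc m) else 0) + sumOver S m f

-- h(x) = #{ (u , v) : u ∈ U , v ∈ V , u + v = x }
-- (pairs are determined by u, with 1 ≤ u ≤ x and v = x - u)
h : (ℕ → Bool) → (ℕ → Bool) → ℕ → ℕ
h U V x = count (λ u → U u ∧ V (x ∸ u)) x

tailSum : (ℕ → ℕ) → ℕ → ℕ → ℕ
tailSum g x zero    = 0
tailSum g x (suc k) = g (x ∸ 2 * suc k) + tailSum g x k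

-- Count the pairs (u , v) ∈ U × V with u + v ≤ x in two ways. Grouped by the value
-- of u + v they number h(1) + h(2) + … + h(x), where h vanishes at even arguments by
-- parity. Grouped as in Dirichlet's hyperbola method with m = (x + 1)/2, every such
-- pair has u ≤ m or v ≤ m, which gives the two sums of the formula, minus the
-- U(m) V(m) pairs counted twice; the only pair of that box with u + v > x is (m , m),
-- which is not in U × V since m cannot be both even and odd.
module Submission where

open import Defs
open import Data.Nat using (ℕ; zero; suc; _+_; _*_; _∸_; _<_; _≤_; _%_; _/_)
open import Data.Nat.Properties
open import Data.Nat.DivMod using (m≡m%n+[m/n]*n; m*n%n≡0; %-distribˡ-+; m*n/n≡m)
open import Data.Nat.Tactic.RingSolver using (solve-∀)
open import Data.Bool using (Bool; true; false; if_then_else_; _∧_)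
open import Data.Bool.Properties using (¬-not; ∧-conicalˡ; ∧-conicalʳ; ∧-zeroʳ)
open import Data.Integer using (+_; _-_) renaming (_+_ to _+ℤ_)
import Data.Integer.Properties as ℤ
open import Data.Product using (_×_; _,_; proj₁; proj₂; ∃)
open import Data.Empty using (⊥)
open import Relation.Binary.PropositionalEquality
open ≡-Reasoning

ind : Bool → ℕ
ind b = if b then 1 else 0

if-then-0≡ind* : ∀ b n → (if b then n else 0) ≡ ind b * n
if-then-0≡ind* true  n = sym (+-identityʳ n)
if-then-0≡ind* false n = refl

ind-∧ : ∀ b c → ind (b ∧ c) ≡ ind b * ind c
ind-∧ true  c = sym (+-identityʳ (ind c))
ind-∧ false c = refl

∧≡false : ∀ b c → (b ≡ true → c ≡ true → ⊥) → b ∧ c ≡ false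
∧≡false b c ¬both = ¬-not (λ b∧c → ¬both (∧-conicalˡ b c b∧c) (∧-conicalʳ b c b∧c))

count-empty : ∀ (S : ℕ → Bool) → (∀ n → S n ≡ false) → ∀ y → count S y ≡ 0
count-empty S empty zero    = refl
count-empty S empty (suc y) rewrite empty (suc y) = count-empty S empty y

count-∸-suc : ∀ {S : ℕ → Bool} → S 0 ≡ false →
              ∀ y u → count S (suc y ∸ u) ≡ ind (S (suc y ∸ u)) + count S (y ∸ u)
count-∸-suc S0 y       zero    = refl
count-∸-suc S0 zero    (suc u) rewrite 0∸n≡0 u | S0 = refl
count-∸-suc S0 (suc y) (suc u) = count-∸-suc S0 y u

sumOver-cong : ∀ S m {f g : ℕ → ℕ} → (∀ n → f n ≡ g n) → sumOver S m f ≡ sumOver S m g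
sumOver-cong S zero    f≗g = refl
sumOver-cong S (suc m) f≗g =
  cong₂ (λ a b → (if S (suc m) then a else 0) + b) (f≗g (suc m)) (sumOver-cong S m f≗g)

sumOver-+ : ∀ S m (f g : ℕ → ℕ) → sumOver S m (λ n → f n + g n) ≡ sumOver S m f + sumOver S m g
sumOver-+ S zero    f g = refl
sumOver-+ S (suc m) f g with S (suc m)
... | true  = trans (cong (λ s → f (suc m) + g (suc m) + s) (sumOver-+ S m f g))
                    (+-+-comm (f (suc m)) (g (suc m)) (sumOver S m f) (sumOver S m g))
  where +-+-comm : ∀ a b c d → a + b + (c + d) ≡ a + c + (b + d)
        +-+-comm = solve-∀
... | false = sumOver-+ S m f g

sumOver-ind≡count-∧ : ∀ (S T : ℕ → Bool) m →
                      sumOver S m (λ n → ind (T n)) ≡ count (λ n → S n ∧ T n) m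
sumOver-ind≡count-∧ S T zero = refl
sumOver-ind≡count-∧ S T (suc m) with S (suc m)
... | true  = cong (λ s → ind (T (suc m)) + s) (sumOver-ind≡count-∧ S T m)
... | false = sumOver-ind≡count-∧ S T m

-- pairs S T a y counts the pairs (s , t) ∈ S × T with s ≤ a and s + t ≤ y.
pairs : (ℕ → Bool) → (ℕ → Bool) → ℕ → ℕ → ℕ
pairs S T a y = sumOver S a (λ s → count T (y ∸ s))

pairs-suc : ∀ S T a {y b} → y ∸ suc a ≡ b →
            pairs S T (suc a) y ≡ ind (S (suc a)) * count T b + pairs S T a y
pairs-suc S T a {y} refl = cong (_+ pairs S T a y) (if-then-0≡ind* (S (suc a)) (count T (y ∸ suc a)))

module _ (U V : ℕ → Bool) where

  pairs-diagonal-suc : V 0 ≡ false → ∀ y →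
                       pairs U V (suc y) (suc y) ≡ h U V (suc y) + pairs U V y y
  pairs-diagonal-suc V0 y = begin
      (if U (suc y) then count V (y ∸ y) else 0) + sumOver U y (λ u → count V (suc y ∸ u))
    ≡⟨ cong₂ _+_ corner-empty (sumOver-cong U y (count-∸-suc V0 y)) ⟩
      sumOver U y (λ u → ind (V (suc y ∸ u)) + count V (y ∸ u))
    ≡⟨ sumOver-+ U y (λ u → ind (V (suc y ∸ u))) (λ u → count V (y ∸ u)) ⟩
      sumOver U y (λ u → ind (V (suc y ∸ u))) + pairs U V y y
    ≡⟨ cong (_+ pairs U V y y) (sumOver-ind≡count-∧ U (λ u → V (suc y ∸ u)) y) ⟩
      count (λ u → U u ∧ V (suc y ∸ u)) y + pairs U V y y
    ≡⟨ cong (λ b → ind b + count (λ u → U u ∧ V (suc y ∸ u)) y + pairs U V y y) last-pair-absent ⟨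
      h U V (suc y) + pairs U V y y ∎
    where
    corner-empty : (if U (suc y) then count V (y ∸ y) else 0) ≡ 0
    corner-empty rewrite n∸n≡0 y = trans (if-then-0≡ind* (U (suc y)) 0) (*-zeroʳ (ind (U (suc y))))
    last-pair-absent : U (suc y) ∧ V (y ∸ y) ≡ false
    last-pair-absent rewrite n∸n≡0 y | V0 = ∧-zeroʳ (U (suc y))

  -- Lattice points under the diagonal, counted along the lines u + v = z.
  pairs-diagonal : V 0 ≡ false → ∀ y → pairs U V y y ≡ sumOver (λ _ → true) y (h U V)
  pairs-diagonal V0 zero    = refl
  pairs-diagonal V0 (suc y) =
    trans (pairs-diagonal-suc V0 y) (cong (λ s → h U V (suc y) + s) (pairs-diagonal V0 y))

  corner-exchange : ∀ a b → let y = suc (a + b) in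
    pairs U V (suc a) y + pairs V U b y + count U a * count V (suc b)
      ≡ pairs U V a y + pairs V U (suc b) y + count U (suc a) * count V b
  corner-exchange a b = begin
      pairs U V (suc a) y + pairs V U b y + count U a * count V (suc b)
    ≡⟨ cong (λ s → s + pairs V U b y + count U a * count V (suc b)) (pairs-suc U V a (m+n∸m≡n a b)) ⟩
      i * count V b + pairs U V a y + pairs V U b y + count U a * (j + count V b)
    ≡⟨ rearrange i j (count U a) (count V b) (pairs U V a y) (pairs V U b y) ⟩
      pairs U V a y + (j * count U a + pairs V U b y) + (i + count U a) * count V b
    ≡⟨ cong (λ s → pairs U V a y + s + count U (suc a) * count V b) (pairs-suc V U b (m+n∸n≡m a b)) ⟨
      pairs U V a y + pairs V U (suc b) y + count U (suc a) * count V b ∎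
    where
    y = suc (a + b)
    i = ind (U (suc a))
    j = ind (V (suc b))
    rearrange : ∀ i j u v p q → i * v + p + q + u * (j + v) ≡ p + (j * u + q) + (i + u) * v
    rearrange = solve-∀

  -- Pairs with u + v ≤ a + b have u ≤ a or v ≤ b; those with both are counted twice.
  hyperbola : ∀ a b → pairs U V a (a + b) + pairs V U b (a + b)
                        ≡ pairs U V (a + b) (a + b) + count U a * count V b
  hyperbola a zero    rewrite +-identityʳ a | *-zeroʳ (count U a) = refl
  hyperbola a (suc b) rewrite +-suc a b = +-cancelʳ-≡ (count U (suc a) * count V b) _ _ (begin
      pairs U V a y + pairs V U (suc b) y + count U (suc a) * count V b
    ≡⟨ corner-exchange a b ⟨
      pairs U V (suc a) y + pairs V U b y + count U a * count V (suc b)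
    ≡⟨ cong (_+ count U a * count V (suc b)) (hyperbola (suc a) b) ⟩
      pairs U V y y + count U (suc a) * count V b + count U a * count V (suc b)
    ≡⟨ +-right-comm (pairs U V y y) _ _ ⟩
      pairs U V y y + count U a * count V (suc b) + count U (suc a) * count V b ∎)
    where
    y = suc (a + b)
    +-right-comm : ∀ p q r → p + q + r ≡ p + r + q
    +-right-comm = solve-∀

  -- When a + b = y + 1 the only doubly counted pair that escapes u + v ≤ y is (a , b).
  hyperbola-overshoot : ∀ a b {y} → suc (a + b) ≡ y →
    pairs U V (suc a) y + pairs V U (suc b) y + ind (U (suc a) ∧ V (suc b))
      ≡ pairs U V y y + count U (suc a) * count V (suc b)
  hyperbola-overshoot a b refl = begin
      pairs U V (suc a) y + pairs V U (suc b) y + ind (U (suc a) ∧ V (suc b))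
    ≡⟨ cong₂ (λ s t → pairs U V (suc a) y + s + t)
             (pairs-suc V U b (m+n∸n≡m a b)) (ind-∧ (U (suc a)) (V (suc b))) ⟩
      pairs U V (suc a) y + (j * count U a + pairs V U b y) + i * j
    ≡⟨ regroup (pairs U V (suc a) y) (pairs V U b y) i j (count U a) ⟩
      (pairs U V (suc a) y + pairs V U b y) + (j * count U a + i * j)
    ≡⟨ cong (_+ (j * count U a + i * j)) (hyperbola (suc a) b) ⟩
      pairs U V y y + (i + count U a) * count V b + (j * count U a + i * j)
    ≡⟨ expand (pairs U V y y) i j (count U a) (count V b) ⟩
      pairs U V y y + (i + count U a) * (j + count V b) ∎
    where
    y = suc (a + b)
    i = ind (U (suc a))
    j = ind (V (suc b))
    regroup : ∀ p q i j u → p + (j * u + q) + i * j ≡ p + q + (j * u + i * j)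
    regroup = solve-∀
    expand : ∀ p i j u v → p + (i + u) * v + (j * u + i * j) ≡ p + (i + u) * (j + v)
    expand = solve-∀

tailSum-suc-suc : ∀ (g : ℕ → ℕ) x k → tailSum g (suc (suc x)) (suc k) ≡ g x + tailSum g x k
tailSum-suc-suc g x zero    = refl
tailSum-suc-suc g x (suc k) = begin
    g (suc (suc x) ∸ 2 * suc (suc k)) + tailSum g (suc (suc x)) (suc k)
  ≡⟨ cong₂ _+_ (cong (λ m → g (suc (suc x) ∸ m)) (*-suc 2 (suc k))) (tailSum-suc-suc g x k) ⟩
    g (x ∸ 2 * suc k) + (g x + tailSum g x k)
  ≡⟨ +-left-comm (g (x ∸ 2 * suc k)) (g x) (tailSum g x k) ⟩
    g x + tailSum g x (suc k) ∎
  where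
  +-left-comm : ∀ p q r → p + (q + r) ≡ q + (p + r)
  +-left-comm = solve-∀

sum-vanishing-on-evens : ∀ (g : ℕ → ℕ) → (∀ n → g (n * 2) ≡ 0) → ∀ q →
  sumOver (λ _ → true) (suc (q * 2)) g ≡ g (suc (q * 2)) + tailSum g (suc (q * 2)) q
sum-vanishing-on-evens g g-even zero    = refl
sum-vanishing-on-evens g g-even (suc q) = cong (λ s → g (suc (suc q * 2)) + s) (begin
    g (suc q * 2) + sumOver (λ _ → true) (suc (q * 2)) g
  ≡⟨ cong₂ _+_ (g-even (suc q)) (sum-vanishing-on-evens g g-even q) ⟩
    g (suc (q * 2)) + tailSum g (suc (q * 2)) q
  ≡⟨ tailSum-suc-suc g (suc (q * 2)) q ⟨
    tailSum g (suc (suc q * 2)) (suc q) ∎)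

even+odd-%2 : ∀ m n → m % 2 ≡ 0 → n % 2 ≡ 1 → (m + n) % 2 ≡ 1
even+odd-%2 m n m-even n-odd = trans (%-distribˡ-+ m n 2) (cong₂ (λ a b → (a + b) % 2) m-even n-odd)

odd⇒≡suc[q*2] : ∀ x → x % 2 ≡ 1 → ∃ λ q → x ≡ suc (q * 2)
odd⇒≡suc[q*2] x x-odd = x / 2 , trans (m≡m%n+[m/n]*n x 2) (cong (_+ x / 2 * 2) x-odd)

[1+q*2+1]/2≡1+q : ∀ q → (suc (q * 2) + 1) / 2 ≡ suc q
[1+q*2+1]/2≡1+q q = trans (cong (_/ 2) (+-comm (suc (q * 2)) 1)) (m*n/n≡m (suc q) 2)

+[m+n]-+n≡+m : ∀ m n → + (m + n) - + n ≡ + m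
+[m+n]-+n≡+m m n = trans (ℤ.m-n≡m⊖n (m + n) n) (trans (ℤ.⊖-≥ (m≤n+m n m)) (cong +_ (m+n∸n≡m m n)))

a+b≡h+t+p⇒+h≡a+b-p-t : ∀ a b {h t p} → a + b ≡ h + t + p → + h ≡ ((+ a +ℤ + b) - + p) - + t
a+b≡h+t+p⇒+h≡a+b-p-t a b {h} {t} {p} a+b≡h+t+p = begin
    + h                             ≡⟨ +[m+n]-+n≡+m h t ⟨
    + (h + t) - + t                 ≡⟨ cong (_- + t) (+[m+n]-+n≡+m (h + t) p) ⟨
    (+ (h + t + p) - + p) - + t     ≡⟨ cong (λ n → (+ n - + p) - + t) a+b≡h+t+p ⟨
    (+ (a + b) - + p) - + t         ≡⟨ cong (λ n → (n - + p) - + t) (ℤ.pos-+ a b) ⟩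
    ((+ a +ℤ + b) - + p) - + t      ∎

module _ {U V : ℕ → Bool}
         (U-even : ∀ n → U n ≡ true → (0 < n) × (n % 2 ≡ 0))
         (V-odd  : ∀ n → V n ≡ true → (0 < n) × (n % 2 ≡ 1)) where

  V-zero : V 0 ≡ false
  V-zero = ¬-not (λ V0 → n≮0 (proj₁ (V-odd 0 V0)))

  U∩V≡∅ : ∀ n → U n ∧ V n ≡ false
  U∩V≡∅ n = ∧≡false (U n) (V n) λ Un Vn →
    0≢1+n (trans (sym (proj₂ (U-even n Un))) (proj₂ (V-odd n Vn)))

  h-even : ∀ n → h U V (n * 2) ≡ 0
  h-even n = count-empty _ (λ u → ∧≡false (U u) (V (n * 2 ∸ u)) (no-pair-sums-to u)) (n * 2)
    where
    no-pair-sums-to : ∀ u → U u ≡ true → V (n * 2 ∸ u) ≡ true → ⊥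
    no-pair-sums-to u Uu Vv = 0≢1+n (begin
        0                          ≡⟨ m*n%n≡0 n 2 ⟨
        n * 2 % 2                  ≡⟨ cong (_% 2) (m+[n∸m]≡n u≤n*2) ⟨
        (u + (n * 2 ∸ u)) % 2      ≡⟨ even+odd-%2 u (n * 2 ∸ u) (proj₂ (U-even u Uu)) (proj₂ (V-odd _ Vv)) ⟩
        1                          ∎)
      where
      u≤n*2 : u ≤ n * 2
      u≤n*2 = <⇒≤ (m∸n≢0⇒n<m (λ v≡0 → n≮0 (subst (0 <_) v≡0 (proj₁ (V-odd _ Vv)))))

  h-odd : ∀ q → let x = suc (q * 2) in
    pairs V U (suc q) x + pairs U V (suc q) x
      ≡ (h U V x + tailSum (h U V) x q) + count U (suc q) * count V (suc q)
  h-odd q = begin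
      pairs V U (suc q) x + pairs U V (suc q) x
    ≡⟨ +-comm (pairs V U (suc q) x) _ ⟩
      pairs U V (suc q) x + pairs V U (suc q) x
    ≡⟨ +-identityʳ _ ⟨
      pairs U V (suc q) x + pairs V U (suc q) x + ind false
    ≡⟨ cong (λ b → pairs U V (suc q) x + pairs V U (suc q) x + ind b) (U∩V≡∅ (suc q)) ⟨
      pairs U V (suc q) x + pairs V U (suc q) x + ind (U (suc q) ∧ V (suc q))
    ≡⟨ hyperbola-overshoot U V q q (cong suc (q+q≡q*2 q)) ⟩
      pairs U V x x + count U (suc q) * count V (suc q)
    ≡⟨ cong (_+ count U (suc q) * count V (suc q)) (pairs-diagonal U V V-zero x) ⟩
      sumOver (λ _ → true) x (h U V) + count U (suc q) * count V (suc q)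
    ≡⟨ cong (_+ count U (suc q) * count V (suc q)) (sum-vanishing-on-evens (h U V) h-even q) ⟩
      (h U V x + tailSum (h U V) x q) + count U (suc q) * count V (suc q) ∎
    where
    x = suc (q * 2)
    q+q≡q*2 : ∀ q → q + q ≡ q * 2
    q+q≡q*2 = solve-∀

  h-odd-ℤ : ∀ q {m k} → m ≡ suc q → k ≡ q → let x = suc (q * 2) in
    + h U V x ≡
      ((+ sumOver V m (λ v → count U (x ∸ v)) +ℤ + sumOver U m (λ u → count V (x ∸ u)))
        - + (count U m * count V m))
        - + tailSum (h U V) x k
  h-odd-ℤ q refl refl = a+b≡h+t+p⇒+h≡a+b-p-t (pairs V U (suc q) x) (pairs U V (suc q) x) (h-odd q)
    where
    x = suc (q * 2)

theorem3 : (U V : ℕ → Bool) →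
           (∀ n → U n ≡ true → (0 < n) × (n % 2 ≡ 0)) →
           (∀ n → V n ≡ true → (0 < n) × (n % 2 ≡ 1)) →
           ∀ x → x % 2 ≡ 1 → 3 ≤ x →
           + h U V x ≡
             ((+ sumOver V ((x + 1) / 2) (λ v → count U (x ∸ v))
               +ℤ + sumOver U ((x + 1) / 2) (λ u → count V (x ∸ u)))
               - + (count U ((x + 1) / 2) * count V ((x + 1) / 2)))
               - + tailSum (h U V) x ((x ∸ 1) / 2)
-- The formula holds for x = 1 as well.
theorem3 U V U-even V-odd x x-odd _ with odd⇒≡suc[q*2] x x-odd
... | q , refl = h-odd-ℤ U-even V-odd q ([1+q*2+1]/2≡1+q q) (m*n/n≡m q 2)
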